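{- Let $L$ be a lattice data structure of height $h$ and $K$ a positive integer. Suppose the last movement in the search path of $K$ ends on diagonal $s$ and column $t$, and put $u=t-2$, $v=h-s+2$. Then (1) the search path of $K$ contains exactly $u$ movements $d$ and exactly $v$ movements $D$; (2) $J(K)\le u+v$ if $u=v$; $J(K)\le 2u+1$ if $u<v$; and $J(K)\le 2v+1$ if $u>v$; (3) $J(K)\le h-1$ if $K$ is a proper key of $L$, and $J(K)\le h$ otherwise.
   Context: Diagram of height $h$: cells $(r,c)$ of positive integers with $r+c\le h+4$; $r$ is the row (numbered bottom to top), $c$ the column (left to right). Diagonal $k$ ($1\le k\le h+3$) is the set of cells with $r+c=k+1$, numbered from head $(k,1)$ to tail $(1,k)$, its $j$-th cell being $(k+1-j,j)$. A lattice data structure (LDS) of height $h$ assigns to each cell an entry in $\{0,\infty\}\cup\mathbb{Z}_{>0}$ such that: (1) all cells of row $1$ and column $1$ contain $0$; (2) all cells of diagonal $h+3$ except head and tail contain $\infty$; (3) for some $0\le m\le h-1$, exactly the cells $(h+3-j,j)$ of diagonal $h+2$ with $h+2-m\le j\le h+1$ contain $\infty$; (4) all remaining cells contain pairwise distinct positive integers (proper keys); (5) proper keys are strictly increasing along each row (left to right), column (bottom to top) and diagonal (head to tail). Order convention: $0<n<\infty$. For a cell $C=(r,c)$: $D=(r-1,c)$, $DR=(r-1,c+1)$. SearchLDS($L,K$): start at $(h+1,2)$; repeatedly: entry $=K$ → stop; entry $=0$ → stop; else move to $DR$ (a "$d$" movement) if $K>$ entry, to $D$ (a "$D$" movement) if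 $K<$ entry. The search path of $K$ is the sequence of movements made until termination; the jump factor $J(K)=J(K;L)$ is the number of maximal blocks of consecutive identical movements in the search path (e.g. $ddddDDDDDdd$ gives $3$). -}

module Defs where

open import Data.Nat using (ℕ; zero; suc; _+_; _∸_; _≤_; _<_; _≥_)
open import Data.Nat.Properties using (<-cmp)
open import Data.List using (List; []; _∷_)
open import Data.Product using (Σ; ∃; _×_; _,_; proj₁; proj₂)
open import Relation.Binary.PropositionalEquality using (_≡_)
open import Relation.Binary.Definitions using (tri<; tri≈; tri>)
open import Relation.Nullary using (¬_)
open import Function.Bundles using (_⇔_)

-- Entries of an LDS: 0, ∞, or a proper key (a natural number, required positive).
data Entry : Set where
  zer : Entry
  ∞   : Entry
  key : ℕ → Entry

InDiagram : ℕ → ℕ → ℕ → Set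
InDiagram h r c = 1 ≤ r × 1 ≤ c × r + c ≤ h + 4

-- Cell (r , c) is a "remaining" cell, i.e. one which must hold a proper key:
-- not in row 1 / column 1, on a diagonal k ≤ h+2 (r + c = k + 1), and not one
-- of the ∞-cells (h+3-j , j), h+2-m ≤ j ≤ h+1, of diagonal h+2.
KeyCell : ℕ → ℕ → ℕ → ℕ → Set
KeyCell h m r c = 2 ≤ r × 2 ≤ c × r + c ≤ h + 3 × ¬ (r + c ≡ h + 3 × h + 2 ≤ c + m)

record LDS (h : ℕ) : Set where
  field
    entry : ℕ → ℕ → Entry   -- entry r c = entry of cell (r , c); only cells of the diagram matter
    row1 : ∀ c → 1 ≤ c → 1 + c ≤ h + 4 → entry 1 c ≡ zer
    col1 : ∀ r → 1 ≤ r → r + 1 ≤ h + 4 → entry r 1 ≡ zer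
    -- (2) diagonal h+3 (cells (h+4-j , j), 1 ≤ j ≤ h+3) except head and tail contains ∞
    diagTop : ∀ j → 2 ≤ j → j ≤ h + 2 → entry (h + 4 ∸ j) j ≡ ∞
    -- (3) on diagonal h+2, the cells (h+3-j , j) with h+2-m ≤ j ≤ h+1 contain ∞, for some 0 ≤ m ≤ h-1
    m     : ℕ
    m<h   : m < h
    diag2 : ∀ j → h + 2 ≤ j + m → j ≤ h + 1 → entry (h + 3 ∸ j) j ≡ ∞
    keys     : ∀ r c → KeyCell h m r c → Σ ℕ λ n → 1 ≤ n × entry r c ≡ key n
    distinct : ∀ r c r' c' n → KeyCell h m r c → KeyCell h m r' c' →
               entry r c ≡ key n → entry r' c' ≡ key n → r ≡ r' × c ≡ c'
    -- (5) strictly increasing along rows (left to right), columns (bottom to top),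
    --     diagonals (head to tail, i.e. increasing column)
    rowInc  : ∀ r c c' a b → KeyCell h m r c → KeyCell h m r c' → c < c' →
              entry r c ≡ key a → entry r c' ≡ key b → a < b
    colInc  : ∀ r r' c a b → KeyCell h m r c → KeyCell h m r' c → r < r' →
              entry r c ≡ key a → entry r' c ≡ key b → a < b
    diagInc : ∀ r c r' c' a b → KeyCell h m r c → KeyCell h m r' c' →
              r + c ≡ r' + c' → c < c' →
              entry r c ≡ key a → entry r' c' ≡ key b → a < b

open LDS public

IsProperKey : ∀ {h} → LDS h → ℕ → Set
IsProperKey {h} L K = Σ ℕ λ r → Σ ℕ λ c → KeyCell h (m L) r c × entry L r c ≡ key K

-- Movements: d = to DR (r-1 , c+1), D = to D (r-1 , c)
data Move : Set where
  d D : Move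

-- SearchLDS from cell (r , c): returns the sequence of movements and the final cell (row , column).
-- Recursion is on the row; row 1 always contains 0, so the row-0 clause is never reached.
searchFrom : (ℕ → ℕ → Entry) → ℕ → ℕ → ℕ → List Move × ℕ × ℕ
searchFrom e K zero c = [] , zero , c
searchFrom e K (suc r) c with e (suc r) c
... | zer = [] , suc r , c
... | ∞ with searchFrom e K r c
...   | p , x = D ∷ p , x
searchFrom e K (suc r) c | key n with <-cmp K n
... | tri< _ _ _ with searchFrom e K r c
...   | p , x = D ∷ p , x
searchFrom e K (suc r) c | key n | tri≈ _ _ _ = [] , suc r , c
searchFrom e K (suc r) c | key n | tri> _ _ _ with searchFrom e K r (suc c)
...   | p , x = d ∷ p , x

search : ∀ {h} → LDS h → ℕ → List Move × ℕ × ℕ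
search {h} L K = searchFrom (entry L) K (suc h) 2

searchPath : ∀ {h} → LDS h → ℕ → List Move
searchPath L K = proj₁ (search L K)

endRow endCol : ∀ {h} → LDS h → ℕ → ℕ
endRow L K = proj₁ (proj₂ (search L K))
endCol L K = proj₂ (proj₂ (search L K))

endDiag : ∀ {h} → LDS h → ℕ → ℕ
endDiag L K = endRow L K + endCol L K ∸ 1

count : Move → List Move → ℕ
count x [] = 0
count d (d ∷ p) = suc (count d p)
count d (D ∷ p) = count d p
count D (D ∷ p) = suc (count D p)
count D (d ∷ p) = count D p

changes : Move → List Move → ℕ
changes x [] = 0
changes d (d ∷ p) = changes d p
changes D (D ∷ p) = changes D p
changes d (D ∷ p) = suc (changes D p)
changes D (d ∷ p) = suc (changes d p)

blocks : List Move → ℕ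
blocks [] = 0
blocks (x ∷ p) = suc (changes x p)

J : ∀ {h} → LDS h → ℕ → ℕ
J L K = blocks (searchPath L K)

-- The search starts at (h + 1 , 2) and every movement goes down one row; a d also goes one
-- column right. So the end cell (r , 2 + #d) satisfies r + #d + #D = h + 1,
-- which gives u and v in (1). The number of blocks is at most the length u + v of the path, and
-- since blocks of d and blocks of D alternate, at most 2 #x + 1 for either movement x; this is (2).
-- Row 1 holds zeros, so the search ends in a row r ≥ 1; if K is a proper key the search ends on
-- its cell, in a row r ≥ 2, because the monotonicity of L keeps that cell inside the cone
-- reachable from the current cell. Hence J(K) ≤ u + v = h + 1 − r gives (3).
module Submission where

open import Defs
open import Data.Nat using (ℕ; zero; suc; _+_; _∸_; _*_; _≤_; _<_; z≤n; s≤s; s≤s⁻¹)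
open import Data.Nat.Properties
open import Data.List using (List; []; _∷_; length)
open import Data.Product using (Σ; _×_; _,_; proj₁; proj₂)
open import Data.Sum using (_⊎_; inj₁; inj₂)
open import Data.Empty using (⊥-elim)
open import Relation.Binary.PropositionalEquality
  using (_≡_; _≢_; refl; sym; trans; cong; cong₂; subst; subst₂; module ≡-Reasoning)
open import Relation.Binary.Definitions using (tri<; tri≈; tri>)
open import Relation.Nullary using (¬_; yes; no)
open import Relation.Nullary.Decidable using (_×-dec_)

other : Move → Move
other d = D
other D = d

length≡count-d+count-D : ∀ p → length p ≡ count d p + count D p
length≡count-d+count-D []      = refl
length≡count-d+count-D (d ∷ p) = cong suc (length≡count-d+count-D p)
length≡count-d+count-D (D ∷ p) = trans (cong suc (length≡count-d+count-D p)) (sym (+-suc _ _))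

changes≤length : ∀ x p → changes x p ≤ length p
changes≤length x []      = z≤n
changes≤length d (d ∷ p) = m≤n⇒m≤1+n (changes≤length d p)
changes≤length d (D ∷ p) = s≤s (changes≤length D p)
changes≤length D (d ∷ p) = s≤s (changes≤length d p)
changes≤length D (D ∷ p) = m≤n⇒m≤1+n (changes≤length D p)

blocks≤length : ∀ p → blocks p ≤ length p
blocks≤length []      = z≤n
blocks≤length (x ∷ p) = s≤s (changes≤length x p)

blocks≤1+changes : ∀ x p → blocks p ≤ suc (changes x p)
blocks≤1+changes x []      = z≤n
blocks≤1+changes d (d ∷ p) = ≤-refl
blocks≤1+changes d (D ∷ p) = n≤1+n _
blocks≤1+changes D (d ∷ p) = n≤1+n _
blocks≤1+changes D (D ∷ p) = ≤-refl

-- Every change into an x-block is paid for by that block's first x; a change out of it by its last.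
changes-from-other≤ : ∀ x p → changes (other x) p ≤ 2 * count x p
changes-from-same≤  : ∀ x p → changes x p ≤ suc (2 * count x p)

changes-from-other≤ x []      = z≤n
changes-from-other≤ d (d ∷ p) = ≤-trans (s≤s (changes-from-same≤ d p)) (≤-reflexive (sym (*-suc 2 _)))
changes-from-other≤ d (D ∷ p) = changes-from-other≤ d p
changes-from-other≤ D (d ∷ p) = changes-from-other≤ D p
changes-from-other≤ D (D ∷ p) = ≤-trans (s≤s (changes-from-same≤ D p)) (≤-reflexive (sym (*-suc 2 _)))

changes-from-same≤ x []      = z≤n
changes-from-same≤ d (d ∷ p) = ≤-trans (changes-from-same≤ d p) (s≤s (*-monoʳ-≤ 2 (n≤1+n _)))
changes-from-same≤ d (D ∷ p) = s≤s (changes-from-other≤ d p)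
changes-from-same≤ D (d ∷ p) = s≤s (changes-from-other≤ D p)
changes-from-same≤ D (D ∷ p) = ≤-trans (changes-from-same≤ D p) (s≤s (*-monoʳ-≤ 2 (n≤1+n _)))

blocks≤2*count+1 : ∀ x p → blocks p ≤ 2 * count x p + 1
blocks≤2*count+1 x p = begin
  blocks p                   ≤⟨ blocks≤1+changes (other x) p ⟩
  suc (changes (other x) p)  ≤⟨ s≤s (changes-from-other≤ x p) ⟩
  suc (2 * count x p)        ≡⟨ +-comm 1 _ ⟩
  2 * count x p + 1          ∎
  where open ≤-Reasoning

module _ (e : ℕ → ℕ → Entry) (K : ℕ) where

  pathFrom : ℕ → ℕ → List Move
  pathFrom r c = proj₁ (searchFrom e K r c)

  rowFrom colFrom : ℕ → ℕ → ℕ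
  rowFrom r c = proj₁ (proj₂ (searchFrom e K r c))
  colFrom r c = proj₂ (proj₂ (searchFrom e K r c))

  rowFrom+length≡r : ∀ r c → rowFrom r c + length (pathFrom r c) ≡ r
  rowFrom+length≡r zero c = refl
  rowFrom+length≡r (suc r) c with e (suc r) c
  ... | zer = +-identityʳ (suc r)
  ... | ∞   = trans (+-suc _ _) (cong suc (rowFrom+length≡r r c))
  ... | key n with <-cmp K n
  ... | tri< _ _ _ = trans (+-suc _ _) (cong suc (rowFrom+length≡r r c))
  ... | tri≈ _ _ _ = +-identityʳ (suc r)
  ... | tri> _ _ _ = trans (+-suc _ _) (cong suc (rowFrom+length≡r r (suc c)))

  colFrom≡c+count-d : ∀ r c → colFrom r c ≡ c + count d (pathFrom r c)
  colFrom≡c+count-d zero c = sym (+-identityʳ c)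
  colFrom≡c+count-d (suc r) c with e (suc r) c
  ... | zer = sym (+-identityʳ c)
  ... | ∞   = colFrom≡c+count-d r c
  ... | key n with <-cmp K n
  ... | tri< _ _ _ = colFrom≡c+count-d r c
  ... | tri≈ _ _ _ = sym (+-identityʳ c)
  ... | tri> _ _ _ = trans (colFrom≡c+count-d r (suc c)) (sym (+-suc c _))

  -- The search from (r + 1 , c) can only reach row 1 in columns c, …, c + r.
  1≤rowFrom : ∀ n r c → (∀ c′ → 1 ≤ c′ → c′ ≤ n → e 1 c′ ≡ zer) →
              1 ≤ c → c + r ≤ n → 1 ≤ rowFrom (suc r) c
  1≤rowFrom n zero c row1-zer 1≤c c≤n with e 1 c | row1-zer c 1≤c (≤-trans (m≤m+n c 0) c≤n)
  ... | zer | _ = s≤s z≤n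
  1≤rowFrom n (suc r) c row1-zer 1≤c bound with e (suc (suc r)) c
  ... | zer = s≤s z≤n
  ... | ∞   = 1≤rowFrom n r c row1-zer 1≤c (≤-trans (+-monoʳ-≤ c (n≤1+n r)) bound)
  ... | key k with <-cmp K k
  ... | tri< _ _ _ = 1≤rowFrom n r c row1-zer 1≤c (≤-trans (+-monoʳ-≤ c (n≤1+n r)) bound)
  ... | tri≈ _ _ _ = s≤s z≤n
  ... | tri> _ _ _ = 1≤rowFrom n r (suc c) row1-zer (s≤s z≤n) (≤-trans (≤-reflexive (sym (+-suc c r))) bound)

key-injective : ∀ {a b} → key a ≡ key b → a ≡ b
key-injective refl = refl

module _ {h : ℕ} (L : LDS h) where

  InfinityCell : ℕ → ℕ → Set
  InfinityCell r c = r + c ≡ h + 3 × h + 2 ≤ c + m L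

  keyCell⊎infinityCell : ∀ r c → 2 ≤ r → 2 ≤ c → r + c ≤ h + 3 →
    (KeyCell h (m L) r c × Σ ℕ λ n → entry L r c ≡ key n) ⊎ (InfinityCell r c × entry L r c ≡ ∞)
  keyCell⊎infinityCell r c 2≤r 2≤c bound with (r + c ≟ h + 3) ×-dec (h + 2 ≤? c + m L)
  ... | no ¬inf = inj₁ (kc , proj₁ k , proj₂ (proj₂ k))
    where
    kc : KeyCell h (m L) r c
    kc = 2≤r , 2≤c , bound , ¬inf
    k : Σ ℕ λ n → 1 ≤ n × entry L r c ≡ key n
    k = keys L r c kc
  ... | yes inf@(diag , tail) =
    inj₂ (inf , subst (λ r′ → entry L r′ c ≡ ∞) row (diag2 L c tail c≤h+1))
    where
    row : h + 3 ∸ c ≡ r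
    row = trans (cong (_∸ c) (sym diag)) (m+n∸n≡m r c)
    c≤h+1 : c ≤ h + 1
    c≤h+1 = +-cancelˡ-≤ 2 c (h + 1)
      (≤-trans (+-monoˡ-≤ c 2≤r) (≤-reflexive (trans diag (trans (sym (+-assoc h 1 2)) (+-comm (h + 1) 2)))))

  diagonal-mono : ∀ {r c r′ c′ a b} → KeyCell h (m L) r c → KeyCell h (m L) r′ c′ →
    r + c ≡ r′ + c′ → c ≤ c′ → entry L r c ≡ key a → entry L r′ c′ ≡ key b → a ≤ b
  diagonal-mono {r} {c} {r′} kc kc′ diag c≤c′ ea eb with m≤n⇒m<n∨m≡n c≤c′
  ... | inj₁ c<c′ = <⇒≤ (diagInc L _ _ _ _ _ _ kc kc′ diag c<c′ ea eb)
  ... | inj₂ refl with +-cancelʳ-≡ c r r′ diag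
  ... | refl = ≤-reflexive (key-injective (trans (sym ea) eb))

  column-mono : ∀ {r r′ c a b} → KeyCell h (m L) r c → KeyCell h (m L) r′ c →
    r ≤ r′ → entry L r c ≡ key a → entry L r′ c ≡ key b → a ≤ b
  column-mono kc kc′ r≤r′ ea eb with m≤n⇒m<n∨m≡n r≤r′
  ... | inj₁ r<r′ = <⇒≤ (colInc L _ _ _ _ _ kc kc′ r<r′ ea eb)
  ... | inj₂ refl = ≤-reflexive (key-injective (trans (sym ea) eb))

  keyCell-off-infinity-tail : ∀ {r c r′ c′} → InfinityCell r c → KeyCell h (m L) r′ c′ →
    c ≤ c′ → r′ + c′ ≢ r + c
  keyCell-off-infinity-tail (diag , tail) (_ , _ , _ , ¬inf) c≤c′ same =
    ¬inf (trans same diag , ≤-trans tail (+-monoˡ-≤ (m L) c≤c′))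

  module _ (K : ℕ) where

    -- Invariant: the cell (r′ , c′) holding K lies in the cone {c ≤ c′ , r′ + c′ ≤ r + c}
    -- of cells reachable from the current cell (r , c) = (r₀ + 1 , c).
    finds-key : ∀ r₀ c {r′ c′} → 2 ≤ c → suc r₀ + c ≤ h + 3 →
      KeyCell h (m L) r′ c′ → entry L r′ c′ ≡ key K → c ≤ c′ → r′ + c′ ≤ suc r₀ + c →
      2 ≤ rowFrom (entry L) K (suc r₀) c
    finds-key zero c {r′} {c′} _ _ (2≤r′ , _) _ c≤c′ cone =
      ⊥-elim (<⇒≱ 2≤r′ (+-cancelʳ-≤ c r′ 1 (≤-trans (+-monoʳ-≤ r′ c≤c′) cone)))
    finds-key (suc r₀) c {r′} {c′} 2≤c bound kc′ eK c≤c′ cone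
      with keyCell⊎infinityCell (suc (suc r₀)) c (s≤s (s≤s z≤n)) 2≤c bound
    ... | inj₂ (inf , e∞) rewrite e∞ =
      finds-key r₀ c 2≤c (≤-trans (n≤1+n _) bound) kc′ eK c≤c′
        (s≤s⁻¹ (≤∧≢⇒< cone (keyCell-off-infinity-tail inf kc′ c≤c′)))
    ... | inj₁ (kc , n , en) rewrite en with <-cmp K n
    ...   | tri≈ _ _ _ = s≤s (s≤s z≤n)
    ...   | tri< K<n _ _ =
      finds-key r₀ c 2≤c (≤-trans (n≤1+n _) bound) kc′ eK c≤c′ (s≤s⁻¹ (≤∧≢⇒< cone off-diagonal))
      where
      off-diagonal : r′ + c′ ≢ suc (suc r₀) + c
      off-diagonal same = <⇒≱ K<n (diagonal-mono kc kc′ (sym same) c≤c′ en eK)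
    ...   | tri> _ _ n<K =
      finds-key r₀ (suc c) (m≤n⇒m≤1+n 2≤c) (≤-trans (≤-reflexive (+-suc (suc r₀) c)) bound)
        kc′ eK (≤∧≢⇒< c≤c′ off-column) (≤-trans cone (≤-reflexive (sym (+-suc (suc r₀) c))))
      where
      off-column : c ≢ c′
      off-column refl = <⇒≱ n<K
        (column-mono kc′ kc (+-cancelʳ-≤ c r′ (suc (suc r₀)) cone) eK en)

module _ {h : ℕ} (L : LDS h) (K : ℕ) where

  private
    path : List Move
    path = searchPath L K

  endRow+length≡1+h : endRow L K + length path ≡ suc h
  endRow+length≡1+h = rowFrom+length≡r (entry L) K (suc h) 2

  count-d≡endCol∸2 : count d path ≡ endCol L K ∸ 2
  count-d≡endCol∸2 = sym (trans (cong (_∸ 2) (colFrom≡c+count-d (entry L) K (suc h) 2)) (m+n∸m≡n 2 _))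

  count-D≡h+2∸endDiag : count D path ≡ h + 2 ∸ endDiag L K
  count-D≡h+2∸endDiag = sym (begin
    h + 2 ∸ (R + endCol L K ∸ 1)          ≡⟨ cong (λ col → h + 2 ∸ (R + col ∸ 1)) (colFrom≡c+count-d (entry L) K (suc h) 2) ⟩
    h + 2 ∸ (R + (2 + u) ∸ 1)             ≡⟨ cong₂ _∸_ (+-comm h 2) (cong (_∸ 1) (trans (+-suc R (suc u)) (cong suc (+-suc R u)))) ⟩
    suc h ∸ (R + u)                        ≡⟨ cong (_∸ (R + u)) (sym R+u+v≡) ⟩
    R + u + count D path ∸ (R + u)         ≡⟨ m+n∸m≡n (R + u) _ ⟩
    count D path                           ∎)
    where
    open ≡-Reasoning
    R u : ℕ
    R = endRow L K
    u = count d path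
    R+u+v≡ : R + u + count D path ≡ suc h
    R+u+v≡ = trans (+-assoc R u _) (trans (cong (R +_) (sym (length≡count-d+count-D path))) endRow+length≡1+h)

  J≤suc-h∸endRow : J L K ≤ suc h ∸ endRow L K
  J≤suc-h∸endRow = ≤-trans (blocks≤length path)
    (≤-reflexive (trans (sym (m+n∸m≡n (endRow L K) _)) (cong (_∸ endRow L K) endRow+length≡1+h)))

  1≤endRow : 1 ≤ endRow L K
  1≤endRow = 1≤rowFrom (entry L) K (h + 3) h 2
    (λ c 1≤c c≤h+3 → row1 L c 1≤c (≤-trans (s≤s c≤h+3) (≤-reflexive (sym (+-suc h 3)))))
    (s≤s z≤n) (≤-trans (≤-reflexive (+-comm 2 h)) (+-monoʳ-≤ h (n≤1+n 2)))

  properKey⇒2≤endRow : IsProperKey L K → 2 ≤ endRow L K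
  properKey⇒2≤endRow (_ , _ , kc@(_ , 2≤c′ , bound , _) , eK) =
    finds-key L K h 2 ≤-refl (≤-reflexive (sym (+-suc h 2))) kc eK 2≤c′
      (≤-trans bound (≤-reflexive (+-suc h 2)))

lemma2 : ∀ h (L : LDS h) (K : ℕ) → 1 ≤ K → searchPath L K ≢ [] →
    (count d (searchPath L K) ≡ endCol L K ∸ 2 × count D (searchPath L K) ≡ h + 2 ∸ endDiag L K)
    × (endCol L K ∸ 2 ≡ h + 2 ∸ endDiag L K → J L K ≤ (endCol L K ∸ 2) + (h + 2 ∸ endDiag L K))
    × (endCol L K ∸ 2 < h + 2 ∸ endDiag L K → J L K ≤ 2 * (endCol L K ∸ 2) + 1)
    × (h + 2 ∸ endDiag L K < endCol L K ∸ 2 → J L K ≤ 2 * (h + 2 ∸ endDiag L K) + 1)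
    × (IsProperKey L K → J L K ≤ h ∸ 1)
    × (¬ IsProperKey L K → J L K ≤ h)
lemma2 h L K _ _ =
  (u≡ , v≡) ,
  (λ _ → subst₂ (λ u v → J L K ≤ u + v) u≡ v≡
           (≤-trans (blocks≤length path) (≤-reflexive (length≡count-d+count-D path)))) ,
  (λ _ → subst (λ u → J L K ≤ 2 * u + 1) u≡ (blocks≤2*count+1 d path)) ,
  (λ _ → subst (λ v → J L K ≤ 2 * v + 1) v≡ (blocks≤2*count+1 D path)) ,
  (λ proper → ≤-trans (J≤suc-h∸endRow L K) (∸-monoʳ-≤ (suc h) (properKey⇒2≤endRow L K proper))) ,
  (λ _ → ≤-trans (J≤suc-h∸endRow L K) (∸-monoʳ-≤ (suc h) (1≤endRow L K)))
  where
  path : List Move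
  path = searchPath L K
  u≡ : count d path ≡ endCol L K ∸ 2
  u≡ = count-d≡endCol∸2 L K
  v≡ : count D path ≡ h + 2 ∸ endDiag L K
  v≡ = count-D≡h+2∸endDiag L K
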